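{- Let $X=C_3^{(1)}$. Then $$\{\mathrm{ht}(\Lambda_0-\mu):\ \mu\in W\Lambda_0\}=\{6(k_1^2+k_2^2+k_3^2)+3k_1+k_2+5k_3:\ k_1,k_2,k_3\in\mathbb{Z}\}.$$ Equivalently, the set of sizes $|\lambda|$ of $0$-core abaci $(\lambda,0)$ of type $C_3^{(1)}$ equals the right-hand side.
   Context: $C_3^{(1)}$ has simple roots $\alpha_0,\alpha_1,\alpha_2,\alpha_3$. Its Cartan matrix $(a_{ik})=(\langle\alpha_i^\vee,\alpha_k\rangle)$ has rows $(2,-1,0,0),(-2,2,-1,0),(0,-1,2,-2),(0,0,-1,2)$. $\Lambda_0$ is the fundamental weight with $\langle\Lambda_0,\alpha_k^\vee\rangle=\delta_{0k}$. $W$ is the affine Weyl group generated by $\sigma_i(v)=v-\langle v,\alpha_i^\vee\rangle\alpha_i$. For $\beta=\sum k_i\alpha_i$, $\mathrm{ht}(\beta)=\sum k_i$. In the paper's abacus model, $0$-core abaci of type $C_3^{(1)}$ correspond bijectively to the elements $\mu=\Lambda_0-\beta$ of the orbit $W\Lambda_0$. For type $C_l^{(1)}$ the size $|\lambda|$ of the corresponding partition equals $\mathrm{ht}(\beta)$. -}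

module Defs where

open import Data.Integer using (ℤ; +_; _+_; _-_; _*_; -_)
open import Data.Fin using (Fin; zero; suc)
open import Data.Vec using (Vec; []; _∷_; lookup; updateAt)

-- Root-lattice coordinates of β = k₀α₀ + k₁α₁ + k₂α₂ + k₃α₃.
-- An element μ of the weight lattice of the form Λ₀ - β is represented by β.
RootVec : Set
RootVec = Vec ℤ 4

-- Cartan matrix of C₃⁽¹⁾ : cartan i k = ⟨αᵢ^∨ , α_k⟩
cartan : Fin 4 → Fin 4 → ℤ
cartan i k = lookup (lookup rows i) k
  where
  rows : Vec (Vec ℤ 4) 4
  rows = (+ 2 ∷ - + 1 ∷ + 0 ∷ + 0 ∷ [])
       ∷ (- + 2 ∷ + 2 ∷ - + 1 ∷ + 0 ∷ [])
       ∷ (+ 0 ∷ - + 1 ∷ + 2 ∷ - + 2 ∷ [])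
       ∷ (+ 0 ∷ + 0 ∷ - + 1 ∷ + 2 ∷ [])
       ∷ []

Λ₀pair : Fin 4 → ℤ
Λ₀pair zero = + 1
Λ₀pair (suc _) = + 0

βpair : RootVec → Fin 4 → ℤ
βpair (b0 ∷ b1 ∷ b2 ∷ b3 ∷ []) i =
  cartan i zero * b0 + cartan i (suc zero) * b1
  + cartan i (suc (suc zero)) * b2 + cartan i (suc (suc (suc zero))) * b3

pairing : RootVec → Fin 4 → ℤ
pairing β i = Λ₀pair i - βpair β i

-- σᵢ(Λ₀ - β) = Λ₀ - β - ⟨Λ₀ - β, αᵢ^∨⟩ αᵢ = Λ₀ - (β + ⟨Λ₀ - β, αᵢ^∨⟩ αᵢ)
reflect : Fin 4 → RootVec → RootVec
reflect i β = updateAt β i (λ x → x + pairing β i)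

-- Λ₀ - β lies in the orbit W Λ₀ (W generated by the σᵢ, each an involution)
data InOrbit : RootVec → Set where
  base : InOrbit (+ 0 ∷ + 0 ∷ + 0 ∷ + 0 ∷ [])
  step : ∀ i {β} → InOrbit β → InOrbit (reflect i β)

ht : RootVec → ℤ
ht (b0 ∷ b1 ∷ b2 ∷ b3 ∷ []) = b0 + b1 + b2 + b3

quadForm : ℤ → ℤ → ℤ → ℤ
quadForm k1 k2 k3 =
  + 6 * (k1 * k1 + k2 * k2 + k3 * k3) + + 3 * k1 + k2 + + 5 * k3

-- The orbit of Λ₀ is parametrised by ℤ³: with s = k₁² + k₂² + k₃², the weight
-- Λ₀ - β with β = (s, 2s + 2k₃, 2s + 2k₁ + 2k₃, s + k₁ + k₂ + k₃) has height
-- exactly the quadratic form of the statement.  In these coordinates σ₀ acts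
-- as k₃ ↦ -1 - k₃, σ₁ swaps k₁ and k₃, σ₂ swaps k₁ and k₂, and σ₃ negates k₂;
-- so every reflection preserves the parametrisation, and the group these
-- affine maps generate (signed permutations and integer translations) is
-- transitive on ℤ³.
module Submission where

open import Defs
open import Data.Integer using (ℤ; +_; -[1+_]; _+_; _*_; -_)
open import Data.Integer.Properties using (neg-involutive)
open import Data.Integer.Solver using (module +-*-Solver)
open import Data.Fin using (Fin; zero; suc)
open import Data.Nat using (zero; suc)
open import Data.Product using (∃; _×_; _,_)
open import Data.Vec using (Vec; []; _∷_; map; updateAt)
open import Data.Vec.Relation.Binary.Pointwise.Inductive using (Pointwise; []; _∷_)
open import Function.Bundles using (_⇔_; mk⇔)
open import Relation.Binary.PropositionalEquality using (_≡_; refl; sym; trans; cong₂; subst)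

orbitPoint : ℤ → ℤ → ℤ → RootVec
orbitPoint k₁ k₂ k₃ =
  s ∷ + 2 * s + + 2 * k₃ ∷ + 2 * s + + 2 * k₁ + + 2 * k₃ ∷ s + k₁ + k₂ + k₃ ∷ []
  where s = k₁ * k₁ + k₂ * k₂ + k₃ * k₃

-- Symbolic copies of orbitPoint, pairing, reflect, ht and quadForm over ring-solver
-- polynomials; their semantics are definitionally the originals.
module Symbolic where
  open +-*-Solver public using (Polynomial; con; var; _:+_; _:*_; _:-_; :-_; ⟦_⟧; prove)

  Term : Set
  Term = Polynomial 3

  k₁ k₂ k₃ : Term
  k₁ = var zero
  k₂ = var (suc zero)
  k₃ = var (suc (suc zero))

  orbitPointᵀ : Term → Term → Term → Vec Term 4
  orbitPointᵀ a b c =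
    s ∷ con (+ 2) :* s :+ con (+ 2) :* c ∷ con (+ 2) :* s :+ con (+ 2) :* a :+ con (+ 2) :* c
      ∷ s :+ a :+ b :+ c ∷ []
    where s = a :* a :+ b :* b :+ c :* c

  pairingᵀ : Vec Term 4 → Fin 4 → Term
  pairingᵀ (b₀ ∷ b₁ ∷ b₂ ∷ b₃ ∷ []) i =
    con (Λ₀pair i) :- (con (cartan i zero) :* b₀ :+ con (cartan i (suc zero)) :* b₁
      :+ con (cartan i (suc (suc zero))) :* b₂ :+ con (cartan i (suc (suc (suc zero)))) :* b₃)

  reflectᵀ : Fin 4 → Vec Term 4 → Vec Term 4
  reflectᵀ i β = updateAt β i (_:+ pairingᵀ β i)

  htᵀ : Vec Term 4 → Term
  htᵀ (b₀ ∷ b₁ ∷ b₂ ∷ b₃ ∷ []) = b₀ :+ b₁ :+ b₂ :+ b₃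

  quadFormᵀ : Term
  quadFormᵀ = con (+ 6) :* (k₁ :* k₁ :+ k₂ :* k₂ :+ k₃ :* k₃)
    :+ con (+ 3) :* k₁ :+ k₂ :+ con (+ 5) :* k₃

  proveᵛ : ∀ {n} (ρ : Vec ℤ 3) (us vs : Vec Term n) →
           Pointwise (λ u v → +-*-Solver.⟦ u ⟧↓ ρ ≡ +-*-Solver.⟦ v ⟧↓ ρ) us vs →
           map (λ u → ⟦ u ⟧ ρ) us ≡ map (λ v → ⟦ v ⟧ ρ) vs
  proveᵛ ρ []       []       []       = refl
  proveᵛ ρ (u ∷ us) (v ∷ vs) (e ∷ es) = cong₂ _∷_ (prove ρ u v e) (proveᵛ ρ us vs es)

open Symbolic using (k₁; k₂; k₃; orbitPointᵀ; reflectᵀ; htᵀ; quadFormᵀ; con; :-_; _:+_; prove; proveᵛ)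

reflect₀-orbitPoint : ∀ a b c → reflect zero (orbitPoint a b c) ≡ orbitPoint a b (- (+ 1 + c))
reflect₀-orbitPoint a b c = proveᵛ (a ∷ b ∷ c ∷ [])
  (reflectᵀ zero (orbitPointᵀ k₁ k₂ k₃)) (orbitPointᵀ k₁ k₂ (:- (con (+ 1) :+ k₃)))
  (refl ∷ refl ∷ refl ∷ refl ∷ [])

reflect₁-orbitPoint : ∀ a b c → reflect (suc zero) (orbitPoint a b c) ≡ orbitPoint c b a
reflect₁-orbitPoint a b c = proveᵛ (a ∷ b ∷ c ∷ [])
  (reflectᵀ (suc zero) (orbitPointᵀ k₁ k₂ k₃)) (orbitPointᵀ k₃ k₂ k₁)
  (refl ∷ refl ∷ refl ∷ refl ∷ [])

reflect₂-orbitPoint : ∀ a b c → reflect (suc (suc zero)) (orbitPoint a b c) ≡ orbitPoint b a c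
reflect₂-orbitPoint a b c = proveᵛ (a ∷ b ∷ c ∷ [])
  (reflectᵀ (suc (suc zero)) (orbitPointᵀ k₁ k₂ k₃)) (orbitPointᵀ k₂ k₁ k₃)
  (refl ∷ refl ∷ refl ∷ refl ∷ [])

reflect₃-orbitPoint : ∀ a b c → reflect (suc (suc (suc zero))) (orbitPoint a b c) ≡ orbitPoint a (- b) c
reflect₃-orbitPoint a b c = proveᵛ (a ∷ b ∷ c ∷ [])
  (reflectᵀ (suc (suc (suc zero))) (orbitPointᵀ k₁ k₂ k₃)) (orbitPointᵀ k₁ (:- k₂) k₃)
  (refl ∷ refl ∷ refl ∷ refl ∷ [])

ht-orbitPoint : ∀ a b c → ht (orbitPoint a b c) ≡ quadForm a b c
ht-orbitPoint a b c = prove (a ∷ b ∷ c ∷ []) (htᵀ (orbitPointᵀ k₁ k₂ k₃)) quadFormᵀ refl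

module AffineC₃-Induction
  (P : ℤ → ℤ → ℤ → Set)
  (P-origin : P (+ 0) (+ 0) (+ 0))
  (σ₀ : ∀ {a b c} → P a b c → P a b (- (+ 1 + c)))
  (σ₁ : ∀ {a b c} → P a b c → P c b a)
  (σ₂ : ∀ {a b c} → P a b c → P b a c)
  (σ₃ : ∀ {a b c} → P a b c → P a (- b) c)
  where

  negate₃ : ∀ {a b c} → P a b c → P a b (- c)
  negate₃ p = σ₁ (σ₂ (σ₃ (σ₂ (σ₁ p))))

  suc₃ : ∀ {a b c} → P a b c → P a b (+ 1 + c)
  suc₃ {a} {b} {c} p = subst (P a b) (neg-involutive (+ 1 + c)) (negate₃ (σ₀ p))

  along₃⁺ : ∀ {a b} n → P a b (+ 0) → P a b (+ n)
  along₃⁺ zero    p = p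
  along₃⁺ (suc n) p = suc₃ (along₃⁺ n p)

  along₃ : ∀ {a b} c → P a b (+ 0) → P a b c
  along₃ (+ n)    p = along₃⁺ n p
  along₃ -[1+ n ] p = negate₃ (along₃⁺ (suc n) p)

  everywhere : ∀ a b c → P a b c
  everywhere a b c = along₃ c (σ₁ (along₃ a (σ₂ (σ₁ (along₃ b P-origin)))))

InOrbit⇒orbitPoint : ∀ {β} → InOrbit β → ∃ λ a → ∃ λ b → ∃ λ c → β ≡ orbitPoint a b c
InOrbit⇒orbitPoint base = + 0 , + 0 , + 0 , refl
InOrbit⇒orbitPoint (step i p) with InOrbit⇒orbitPoint p
InOrbit⇒orbitPoint (step zero p)                   | a , b , c , refl = a , b , - (+ 1 + c) , reflect₀-orbitPoint a b c
InOrbit⇒orbitPoint (step (suc zero) p)             | a , b , c , refl = c , b , a , reflect₁-orbitPoint a b c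
InOrbit⇒orbitPoint (step (suc (suc zero)) p)       | a , b , c , refl = b , a , c , reflect₂-orbitPoint a b c
InOrbit⇒orbitPoint (step (suc (suc (suc zero))) p) | a , b , c , refl = a , - b , c , reflect₃-orbitPoint a b c

orbitPoint-InOrbit : ∀ a b c → InOrbit (orbitPoint a b c)
orbitPoint-InOrbit = AffineC₃-Induction.everywhere (λ a b c → InOrbit (orbitPoint a b c)) base
  (λ {a} {b} {c} p → subst InOrbit (reflect₀-orbitPoint a b c) (step zero p))
  (λ {a} {b} {c} p → subst InOrbit (reflect₁-orbitPoint a b c) (step (suc zero) p))
  (λ {a} {b} {c} p → subst InOrbit (reflect₂-orbitPoint a b c) (step (suc (suc zero)) p))
  (λ {a} {b} {c} p → subst InOrbit (reflect₃-orbitPoint a b c) (step (suc (suc (suc zero))) p))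

proposition5p11 : (n : ℤ) →
    (∃ λ (β : RootVec) → InOrbit β × ht β ≡ n) ⇔
    (∃ λ (k1 : ℤ) → ∃ λ (k2 : ℤ) → ∃ λ (k3 : ℤ) → quadForm k1 k2 k3 ≡ n)
proposition5p11 n = mk⇔ orbit⇒form form⇒orbit
  where
  orbit⇒form : (∃ λ β → InOrbit β × ht β ≡ n) → ∃ λ a → ∃ λ b → ∃ λ c → quadForm a b c ≡ n
  orbit⇒form (β , p , htβ≡n) with InOrbit⇒orbitPoint p
  ... | a , b , c , refl = a , b , c , trans (sym (ht-orbitPoint a b c)) htβ≡n

  form⇒orbit : (∃ λ a → ∃ λ b → ∃ λ c → quadForm a b c ≡ n) → ∃ λ β → InOrbit β × ht β ≡ n
  form⇒orbit (a , b , c , q≡n) =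
    orbitPoint a b c , orbitPoint-InOrbit a b c , trans (ht-orbitPoint a b c) q≡n
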